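{- Let $G$ be a graph such that $\mathrm{core}(G)$ is a critical set. Then $\mathrm{core}(G)\subseteq \bigcap\{A : A \text{ is an inclusion maximal critical independent set of } G\}$.
   Context: $G$ is a finite simple graph. For $X\subseteq V(G)$, $N(X)=\{v\in V(G): N(v)\cap X\neq\emptyset\}$, $d(X)=|X|-|N(X)|$, and $d(G)=\max\{d(X):X\subseteq V(G)\}$; $X$ is a critical set if $d(X)=d(G)$. An independent set $A$ is a critical independent set if $d(A)=\max\{d(I): I\text{ independent in }G\}$. $\Omega(G)$ is the family of maximum independent sets of $G$ and $\mathrm{core}(G)=\bigcap\{S:S\in\Omega(G)\}$. -}

module Defs where

open import Data.Nat using (ℕ)
open import Data.Bool using (Bool; true; false; _∧_)
open import Data.Fin using (Fin)
open import Data.Fin.Subset using (Subset; _∈_; _⊆_; ∣_∣)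
open import Data.Vec using (tabulate; lookup)
open import Data.List using (allFin)
open import Data.Bool.ListAction using (any)
open import Data.Integer using (ℤ; _-_; _≤_; +_)
open import Relation.Binary.PropositionalEquality using (_≡_)
open import Data.Product using (_×_)

record Graph (n : ℕ) : Set where
  field
    adj   : Fin n → Fin n → Bool
    sym   : ∀ u v → adj u v ≡ adj v u
    irrefl : ∀ v → adj v v ≡ false
open Graph public

module _ {n : ℕ} (G : Graph n) where

  N : Subset n → Subset n
  N X = tabulate (λ v → any (λ u → adj G v u ∧ lookup X u) (allFin n))

  d : Subset n → ℤ
  d X = + ∣ X ∣ - + ∣ N X ∣

  IsCritical : Subset n → Set
  IsCritical X = ∀ Y → d Y ≤ d X

  IsIndependent : Subset n → Set
  IsIndependent A = ∀ u v → u ∈ A → v ∈ A → adj G u v ≡ false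

  IsCriticalIndependent : Subset n → Set
  IsCriticalIndependent A =
    IsIndependent A × (∀ I → IsIndependent I → d I ≤ d A)

  IsMaximalCriticalIndependent : Subset n → Set
  IsMaximalCriticalIndependent A =
    IsCriticalIndependent A × (∀ B → IsCriticalIndependent B → A ⊆ B → B ⊆ A)

  IsMaximumIndependent : Subset n → Set
  IsMaximumIndependent S =
    IsIndependent S × (∀ I → IsIndependent I → ∣ I ∣ Data.Nat.≤ ∣ S ∣)

  IsCore : Subset n → Set
  IsCore C = ∀ x → (x ∈ C → ∀ S → IsMaximumIndependent S → x ∈ S)
                 × ((∀ S → IsMaximumIndependent S → x ∈ S) → x ∈ C)

-- For a critical independent set A and any T ⊆ N(A), criticality applied to the
-- independent set A ─ N(T) yields Hall's condition ∣T∣ ≤ ∣A ∩ N(T)∣.  Hence for a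
-- maximum independent S, the independent set A ∪ (S ─ N(A)) is at least as large
-- as S: A lies in a maximum independent set, which contains core(G) too, so
-- A ∪ core(G) is independent.  The function d is supermodular,
-- d(X) + d(Y) ≤ d(X ∪ Y) + d(X ∩ Y), so criticality of core(G) gives
-- d(A) ≤ d(A ∪ core(G)); thus A ∪ core(G) is a critical independent superset
-- of A, and maximality of A forces core(G) ⊆ A.

module Submission where

open import Defs hiding (sym)
open import Data.Nat as ℕ using (ℕ; zero; suc; _+_)
import Data.Nat.Properties as ℕP
open import Data.Nat.Tactic.RingSolver renaming (solve-∀ to ℕ-solve-∀)
open import Data.Integer as ℤ using (+_; -_)
import Data.Integer.Properties as ℤP
open import Data.Integer.Tactic.RingSolver using (solve-∀)
open import Data.Bool using (true; false; T; _∧_)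
open import Data.Bool.ListAction using (any)
open import Data.Bool.Properties using (T-≡; T-∧; ¬-not)
import Data.Bool as Bool
open import Data.Fin.Properties using (all?)
open import Data.Fin.Subset
open import Data.Fin.Subset.Properties
open import Data.Vec using ([]; _∷_; there; lookup; tabulate)
open import Data.Vec.Properties using (lookup∘tabulate; []=⇒lookup; lookup⇒[]=)
open import Data.List using (allFin)
import Data.List.Relation.Unary.Any as Any
open import Data.List.Relation.Unary.Any.Properties using (any⁺; any⁻)
open import Data.List.Membership.Propositional.Properties using (∈-allFin)
open import Data.Product using (∃; _×_; _,_; proj₁; proj₂)
open import Data.Sum using (inj₁; inj₂)
open import Function.Bundles using (module Equivalence)
open Equivalence using (to; from)
open import Level using (Level)
open import Relation.Nullary using (yes; no; contradiction)
open import Relation.Nullary.Decidable using (_×-dec_; _→-dec_)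
open import Relation.Unary using (Pred; Decidable)
open import Relation.Binary.PropositionalEquality

private variable
  ℓ : Level
  n : ℕ

∣p∪q∣+∣p∩q∣≡∣p∣+∣q∣ : ∀ (p q : Subset n) → ∣ p ∪ q ∣ + ∣ p ∩ q ∣ ≡ ∣ p ∣ + ∣ q ∣
∣p∪q∣+∣p∩q∣≡∣p∣+∣q∣ []          []          = refl
∣p∪q∣+∣p∩q∣≡∣p∣+∣q∣ (inside  ∷ p) (inside  ∷ q) =
  cong suc (trans (ℕP.+-suc _ _) (trans (cong suc (∣p∪q∣+∣p∩q∣≡∣p∣+∣q∣ p q)) (sym (ℕP.+-suc _ _))))
∣p∪q∣+∣p∩q∣≡∣p∣+∣q∣ (inside  ∷ p) (outside ∷ q) = cong suc (∣p∪q∣+∣p∩q∣≡∣p∣+∣q∣ p q)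
∣p∪q∣+∣p∩q∣≡∣p∣+∣q∣ (outside ∷ p) (inside  ∷ q) =
  trans (cong suc (∣p∪q∣+∣p∩q∣≡∣p∣+∣q∣ p q)) (sym (ℕP.+-suc _ _))
∣p∪q∣+∣p∩q∣≡∣p∣+∣q∣ (outside ∷ p) (outside ∷ q) = ∣p∪q∣+∣p∩q∣≡∣p∣+∣q∣ p q

∣p∩q∣+∣p─q∣≡∣p∣ : ∀ (p q : Subset n) → ∣ p ∩ q ∣ + ∣ p ─ q ∣ ≡ ∣ p ∣
∣p∩q∣+∣p─q∣≡∣p∣ []          []          = refl
∣p∩q∣+∣p─q∣≡∣p∣ (inside  ∷ p) (inside  ∷ q) = cong suc (∣p∩q∣+∣p─q∣≡∣p∣ p q)
∣p∩q∣+∣p─q∣≡∣p∣ (inside  ∷ p) (outside ∷ q) = trans (ℕP.+-suc _ _) (cong suc (∣p∩q∣+∣p─q∣≡∣p∣ p q))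
∣p∩q∣+∣p─q∣≡∣p∣ (outside ∷ p) (inside  ∷ q) = ∣p∩q∣+∣p─q∣≡∣p∣ p q
∣p∩q∣+∣p─q∣≡∣p∣ (outside ∷ p) (outside ∷ q) = ∣p∩q∣+∣p─q∣≡∣p∣ p q

x∈p─q⇒x∉q : ∀ {p q : Subset n} {x} → x ∈ p ─ q → x ∉ q
x∈p─q⇒x∉q {p = _ ∷ _} {_ ∷ _} (there x∈p─q) (there x∈q) = x∈p─q⇒x∉q x∈p─q x∈q

∪-least : ∀ {p q r : Subset n} → p ⊆ r → q ⊆ r → p ∪ q ⊆ r
∪-least {p = p} {q} p⊆r q⊆r x∈p∪q with x∈p∪q⁻ p q x∈p∪q
... | inj₁ x∈p = p⊆r x∈p
... | inj₂ x∈q = q⊆r x∈q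

disjoint⇒∣p∣+∣q∣≤∣r∣ : ∀ {p q r : Subset n} → (∀ {x} → x ∈ p → x ∉ q) →
                       p ⊆ r → q ⊆ r → ∣ p ∣ + ∣ q ∣ ℕ.≤ ∣ r ∣
disjoint⇒∣p∣+∣q∣≤∣r∣ {n} {p} {q} {r} disjoint p⊆r q⊆r = begin
  ∣ p ∣ + ∣ q ∣              ≡⟨ sym (∣p∪q∣+∣p∩q∣≡∣p∣+∣q∣ p q) ⟩
  ∣ p ∪ q ∣ + ∣ p ∩ q ∣      ≡⟨ cong (λ s → ∣ p ∪ q ∣ + ∣ s ∣) p∩q≡⊥ ⟩
  ∣ p ∪ q ∣ + ∣ ⊥ {n = n} ∣  ≡⟨ cong (λ k → ∣ p ∪ q ∣ + k) (∣⊥∣≡0 n) ⟩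
  ∣ p ∪ q ∣ + 0              ≡⟨ ℕP.+-identityʳ _ ⟩
  ∣ p ∪ q ∣                  ≤⟨ p⊆q⇒∣p∣≤∣q∣ (∪-least p⊆r q⊆r) ⟩
  ∣ r ∣                      ∎
  where
  open ℕP.≤-Reasoning
  p∩q≡⊥ : p ∩ q ≡ ⊥
  p∩q≡⊥ = Empty-unique λ (x , x∈p∩q) →
    let x∈p , x∈q = x∈p∩q⁻ p q x∈p∩q in disjoint x∈p x∈q

maximum-∣∣ : ∀ {P : Pred (Subset n) ℓ} → Decidable P → ∀ {S} → P S →
             ∃ λ M → P M × (∀ I → P I → ∣ I ∣ ℕ.≤ ∣ M ∣)
maximum-∣∣ {n} {P = P} P? {S} PS = climb n S PS (ℕP.m≤n+m n ∣ S ∣)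
  where
  -- Each step strictly enlarges the set, so fuel m with n ≤ ∣ S ∣ + m suffices.
  climb : ∀ m S → P S → n ℕ.≤ ∣ S ∣ + m → ∃ λ M → P M × (∀ I → P I → ∣ I ∣ ℕ.≤ ∣ M ∣)
  climb zero S PS n≤∣S∣ =
    S , PS , λ I _ → ℕP.≤-trans (∣p∣≤n I) (subst (n ℕ.≤_) (ℕP.+-identityʳ _) n≤∣S∣)
  climb (suc m) S PS n≤∣S∣+1+m
    with anySubset? (λ I → P? I ×-dec (∣ S ∣ ℕ.<? ∣ I ∣))
  ... | yes (I , PI , ∣S∣<∣I∣) =
    climb m I PI (ℕP.≤-trans n≤∣S∣+1+m
                   (ℕP.≤-trans (ℕP.≤-reflexive (ℕP.+-suc _ m)) (ℕP.+-monoˡ-≤ m ∣S∣<∣I∣)))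
  ... | no ∄I = S , PS , λ I PI → ℕP.≮⇒≥ (λ ∣S∣<∣I∣ → ∄I (I , PI , ∣S∣<∣I∣))

+m-+n≤+p-+q⇒m+q≤p+n : ∀ m n p q → + m ℤ.- + n ℤ.≤ + p ℤ.- + q → m + q ℕ.≤ p + n
+m-+n≤+p-+q⇒m+q≤p+n m n p q h = ℤP.drop‿+≤+ (begin
  + (m + q)                          ≡⟨ ℤP.pos-+ m q ⟩
  + m ℤ.+ + q                        ≡⟨ shift (+ m) (+ n) (+ q) ⟩
  (+ m ℤ.- + n) ℤ.+ (+ n ℤ.+ + q)    ≤⟨ ℤP.+-monoˡ-≤ (+ n ℤ.+ + q) h ⟩
  (+ p ℤ.- + q) ℤ.+ (+ n ℤ.+ + q)    ≡⟨ shift′ (+ p) (+ q) (+ n) ⟩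
  + p ℤ.+ + n                        ≡⟨ ℤP.pos-+ p n ⟨
  + (p + n)                          ∎)
  where
  open ℤP.≤-Reasoning
  shift : ∀ i j k → i ℤ.+ k ≡ (i ℤ.- j) ℤ.+ (j ℤ.+ k)
  shift = solve-∀
  shift′ : ∀ i j k → (i ℤ.- j) ℤ.+ (k ℤ.+ j) ≡ i ℤ.+ k
  shift′ = solve-∀

[+m-+n]+[+p-+q]≡+[m+p]-+[n+q] : ∀ m n p q →
  (+ m ℤ.- + n) ℤ.+ (+ p ℤ.- + q) ≡ + (m + p) ℤ.- + (n + q)
[+m-+n]+[+p-+q]≡+[m+p]-+[n+q] m n p q = begin
  (+ m ℤ.- + n) ℤ.+ (+ p ℤ.- + q)    ≡⟨ interchange (+ m) (+ n) (+ p) (+ q) ⟩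
  (+ m ℤ.+ + p) ℤ.- (+ n ℤ.+ + q)    ≡⟨ cong₂ ℤ._-_ (ℤP.pos-+ m p) (ℤP.pos-+ n q) ⟨
  + (m + p) ℤ.- + (n + q)            ∎
  where
  open ≡-Reasoning
  interchange : ∀ i j k l → (i ℤ.- j) ℤ.+ (k ℤ.- l) ≡ (i ℤ.+ k) ℤ.- (j ℤ.+ l)
  interchange = solve-∀

+-cancelʳ-≤ : ∀ {i j} k → i ℤ.+ k ℤ.≤ j ℤ.+ k → i ℤ.≤ j
+-cancelʳ-≤ {i} {j} k h = begin
  i                    ≡⟨ undo i k ⟩
  (i ℤ.+ k) ℤ.- k      ≤⟨ ℤP.+-monoˡ-≤ (- k) h ⟩
  (j ℤ.+ k) ℤ.- k      ≡⟨ undo j k ⟨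
  j                    ∎
  where
  open ℤP.≤-Reasoning
  undo : ∀ i k → i ≡ (i ℤ.+ k) ℤ.- k
  undo = solve-∀

module _ (G : Graph n) where

  lookup-N : ∀ X v → lookup (N G X) v ≡ any (λ u → adj G v u ∧ lookup X u) (allFin n)
  lookup-N X = lookup∘tabulate (λ v → any (λ u → adj G v u ∧ lookup X u) (allFin n))

  ∈N⁻ : ∀ {X v} → v ∈ N G X → ∃ λ u → adj G v u ≡ true × u ∈ X
  ∈N⁻ {X} {v} v∈NX =
    let u , adj∧u∈X = Any.satisfied (any⁻ _ (allFin n) (from T-≡ any≡true))
        adjT , u∈XT = to T-∧ adj∧u∈X
    in u , to T-≡ adjT , lookup⇒[]= u X (to T-≡ u∈XT)
    where
    any≡true : any (λ u → adj G v u ∧ lookup X u) (allFin n) ≡ true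
    any≡true = trans (sym (lookup-N X v)) ([]=⇒lookup v∈NX)

  ∈N⁺ : ∀ {X u v} → adj G v u ≡ true → u ∈ X → v ∈ N G X
  ∈N⁺ {X} {u} {v} adj≡true u∈X = lookup⇒[]= v (N G X)
    (trans (lookup-N X v) (to T-≡ (any⁺ _ (Any.map (λ { refl → adj∧u∈X }) (∈-allFin u)))))
    where
    adj∧u∈X : T (adj G v u ∧ lookup X u)
    adj∧u∈X = from T-∧ (from T-≡ adj≡true , from T-≡ ([]=⇒lookup u∈X))

  N-mono : ∀ {X Y} → X ⊆ Y → N G X ⊆ N G Y
  N-mono X⊆Y v∈NX = let u , adj≡true , u∈X = ∈N⁻ v∈NX in ∈N⁺ adj≡true (X⊆Y u∈X)

  N[X∪Y]⊆N[X]∪N[Y] : ∀ X Y → N G (X ∪ Y) ⊆ N G X ∪ N G Y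
  N[X∪Y]⊆N[X]∪N[Y] X Y v∈N[X∪Y] with ∈N⁻ v∈N[X∪Y]
  ... | u , adj≡true , u∈X∪Y with x∈p∪q⁻ X Y u∈X∪Y
  ...   | inj₁ u∈X = x∈p∪q⁺ (inj₁ (∈N⁺ adj≡true u∈X))
  ...   | inj₂ u∈Y = x∈p∪q⁺ (inj₂ (∈N⁺ adj≡true u∈Y))

  N[X∩Y]⊆N[X]∩N[Y] : ∀ X Y → N G (X ∩ Y) ⊆ N G X ∩ N G Y
  N[X∩Y]⊆N[X]∩N[Y] X Y v∈N[X∩Y] =
    x∈p∩q⁺ (N-mono (p∩q⊆p X Y) v∈N[X∩Y] , N-mono (p∩q⊆q X Y) v∈N[X∩Y])

  ∣N[X∪Y]∣+∣N[X∩Y]∣≤∣N[X]∣+∣N[Y]∣ : ∀ X Y →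
    ∣ N G (X ∪ Y) ∣ + ∣ N G (X ∩ Y) ∣ ℕ.≤ ∣ N G X ∣ + ∣ N G Y ∣
  ∣N[X∪Y]∣+∣N[X∩Y]∣≤∣N[X]∣+∣N[Y]∣ X Y = begin
    ∣ N G (X ∪ Y) ∣ + ∣ N G (X ∩ Y) ∣      ≤⟨ ℕP.+-mono-≤ (p⊆q⇒∣p∣≤∣q∣ (N[X∪Y]⊆N[X]∪N[Y] X Y))
                                                          (p⊆q⇒∣p∣≤∣q∣ (N[X∩Y]⊆N[X]∩N[Y] X Y)) ⟩
    ∣ N G X ∪ N G Y ∣ + ∣ N G X ∩ N G Y ∣  ≡⟨ ∣p∪q∣+∣p∩q∣≡∣p∣+∣q∣ (N G X) (N G Y) ⟩
    ∣ N G X ∣ + ∣ N G Y ∣                  ∎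
    where open ℕP.≤-Reasoning

  d-supermodular : ∀ X Y → d G X ℤ.+ d G Y ℤ.≤ d G (X ∪ Y) ℤ.+ d G (X ∩ Y)
  d-supermodular X Y = begin
    d G X ℤ.+ d G Y
      ≡⟨ [+m-+n]+[+p-+q]≡+[m+p]-+[n+q] (∣ X ∣) (∣ N G X ∣) (∣ Y ∣) (∣ N G Y ∣) ⟩
    + (∣ X ∣ + ∣ Y ∣) ℤ.- + (∣ N G X ∣ + ∣ N G Y ∣)
      ≡⟨ cong (λ k → + k ℤ.- + (∣ N G X ∣ + ∣ N G Y ∣)) (∣p∪q∣+∣p∩q∣≡∣p∣+∣q∣ X Y) ⟨
    + (∣ X ∪ Y ∣ + ∣ X ∩ Y ∣) ℤ.- + (∣ N G X ∣ + ∣ N G Y ∣)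
      ≤⟨ ℤP.+-monoʳ-≤ (+ (∣ X ∪ Y ∣ + ∣ X ∩ Y ∣))
           (ℤP.neg-mono-≤ (ℤ.+≤+ (∣N[X∪Y]∣+∣N[X∩Y]∣≤∣N[X]∣+∣N[Y]∣ X Y))) ⟩
    + (∣ X ∪ Y ∣ + ∣ X ∩ Y ∣) ℤ.- + (∣ N G (X ∪ Y) ∣ + ∣ N G (X ∩ Y) ∣)
      ≡⟨ [+m-+n]+[+p-+q]≡+[m+p]-+[n+q]
           (∣ X ∪ Y ∣) (∣ N G (X ∪ Y) ∣) (∣ X ∩ Y ∣) (∣ N G (X ∩ Y) ∣) ⟨
    d G (X ∪ Y) ℤ.+ d G (X ∩ Y)
      ∎
    where open ℤP.≤-Reasoning

  d≤d[X∪C] : ∀ {C} → IsCritical G C → ∀ X → d G X ℤ.≤ d G (X ∪ C)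
  d≤d[X∪C] {C} critical X = +-cancelʳ-≤ (d G C) (begin
    d G X ℤ.+ d G C              ≤⟨ d-supermodular X C ⟩
    d G (X ∪ C) ℤ.+ d G (X ∩ C)  ≤⟨ ℤP.+-monoʳ-≤ (d G (X ∪ C)) (critical (X ∩ C)) ⟩
    d G (X ∪ C) ℤ.+ d G C        ∎)
    where open ℤP.≤-Reasoning

  ∪-critical-independent : ∀ {A C} → IsCriticalIndependent G A → IsCritical G C →
                           IsIndependent G (A ∪ C) → IsCriticalIndependent G (A ∪ C)
  ∪-critical-independent {A} (_ , critA) critC indA∪C =
    indA∪C , λ I indI → ℤP.≤-trans (critA I indI) (d≤d[X∪C] critC A)

  independent? : Decidable (IsIndependent G)
  independent? I = all? λ u → all? λ v → u ∈? I →-dec v ∈? I →-dec adj G u v Bool.≟ false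

  ∅-independent : IsIndependent G ⊥
  ∅-independent u v u∈⊥ _ = contradiction u∈⊥ ∉⊥

  independent-⊆ : ∀ {I J} → IsIndependent G J → I ⊆ J → IsIndependent G I
  independent-⊆ indJ I⊆J u v u∈I v∈I = indJ u v (I⊆J u∈I) (I⊆J v∈I)

  independent⇒∉N : ∀ {I v} → IsIndependent G I → v ∈ I → v ∉ N G I
  independent⇒∉N {I} indI v∈I v∈NI =
    let u , adj≡true , u∈I = ∈N⁻ {I} v∈NI in
    contradiction (trans (sym adj≡true) (indI _ u v∈I u∈I)) λ ()

  independent-∪ : ∀ {I J} → IsIndependent G I → IsIndependent G J →
                  (∀ {v} → v ∈ J → v ∉ N G I) → IsIndependent G (I ∪ J)
  independent-∪ {I} {J} indI indJ J∩NI≡∅ u v u∈I∪J v∈I∪J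
    with x∈p∪q⁻ I J u∈I∪J | x∈p∪q⁻ I J v∈I∪J
  ... | inj₁ u∈I | inj₁ v∈I = indI u v u∈I v∈I
  ... | inj₁ u∈I | inj₂ v∈J =
    ¬-not λ adj≡true → J∩NI≡∅ v∈J (∈N⁺ (trans (Graph.sym G v u) adj≡true) u∈I)
  ... | inj₂ u∈J | inj₁ v∈I = ¬-not λ adj≡true → J∩NI≡∅ u∈J (∈N⁺ adj≡true v∈I)
  ... | inj₂ u∈J | inj₂ v∈J = indJ u v u∈J v∈J

  d≤d⇒∣X∣+∣NY∣≤∣Y∣+∣NX∣ : ∀ {X Y} → d G X ℤ.≤ d G Y → ∣ X ∣ + ∣ N G Y ∣ ℕ.≤ ∣ Y ∣ + ∣ N G X ∣
  d≤d⇒∣X∣+∣NY∣≤∣Y∣+∣NX∣ {X} {Y} = +m-+n≤+p-+q⇒m+q≤p+n (∣ X ∣) (∣ N G X ∣) (∣ Y ∣) (∣ N G Y ∣)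

  critical-independent-hall : ∀ {A T} → IsCriticalIndependent G A → T ⊆ N G A →
                              ∣ T ∣ ℕ.≤ ∣ A ∩ N G T ∣
  critical-independent-hall {A} {T} (indA , critA) T⊆NA =
    ℕP.+-cancelˡ-≤ (∣ A′ ∣ + ∣ N G A′ ∣) _ _ (begin
    (∣ A′ ∣ + ∣ N G A′ ∣) + ∣ T ∣      ≡⟨ ℕP.+-assoc (∣ A′ ∣) _ _ ⟩
    ∣ A′ ∣ + (∣ N G A′ ∣ + ∣ T ∣)      ≤⟨ ℕP.+-monoʳ-≤ (∣ A′ ∣) NA′+T≤NA ⟩
    ∣ A′ ∣ + ∣ N G A ∣                 ≤⟨ d≤d⇒∣X∣+∣NY∣≤∣Y∣+∣NX∣ {A′} {A} (critA A′ indA′) ⟩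
    ∣ A ∣ + ∣ N G A′ ∣                 ≡⟨ cong (_+ ∣ N G A′ ∣) (∣p∩q∣+∣p─q∣≡∣p∣ A (N G T)) ⟨
    (∣ A ∩ N G T ∣ + ∣ A′ ∣) + ∣ N G A′ ∣ ≡⟨ rearrange (∣ A ∩ N G T ∣) (∣ A′ ∣) (∣ N G A′ ∣) ⟩
    (∣ A′ ∣ + ∣ N G A′ ∣) + ∣ A ∩ N G T ∣ ∎)
    where
    open ℕP.≤-Reasoning
    A′ : Subset n
    A′ = A ─ N G T
    indA′ : IsIndependent G A′
    indA′ = independent-⊆ indA (p─q⊆p A (N G T))
    NA′∩T≡∅ : ∀ {v} → v ∈ N G A′ → v ∉ T
    NA′∩T≡∅ v∈NA′ v∈T = let u , adj≡true , u∈A′ = ∈N⁻ {A′} v∈NA′ in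
      x∈p─q⇒x∉q {p = A} u∈A′ (∈N⁺ (trans (Graph.sym G u _) adj≡true) v∈T)
    NA′+T≤NA : ∣ N G A′ ∣ + ∣ T ∣ ℕ.≤ ∣ N G A ∣
    NA′+T≤NA = disjoint⇒∣p∣+∣q∣≤∣r∣ NA′∩T≡∅ (N-mono (p─q⊆p A (N G T))) T⊆NA
    rearrange : ∀ c a b → (c + a) + b ≡ (a + b) + c
    rearrange = ℕ-solve-∀

  critical-independent-extends : ∀ {A S} → IsCriticalIndependent G A → IsIndependent G S →
    ∃ λ S′ → IsIndependent G S′ × A ⊆ S′ × ∣ S ∣ ℕ.≤ ∣ S′ ∣
  critical-independent-extends {A} {S} critIndA@(indA , _) indS =
    A ∪ S─NA , independent-∪ indA indS─NA x∈p─q⇒x∉q , p⊆p∪q S─NA , (begin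
      ∣ S ∣                       ≡⟨ ∣p∩q∣+∣p─q∣≡∣p∣ S (N G A) ⟨
      ∣ S∩NA ∣ + ∣ S─NA ∣         ≤⟨ ℕP.+-monoˡ-≤ (∣ S─NA ∣) hall ⟩
      ∣ A ∩ N G S∩NA ∣ + ∣ S─NA ∣ ≤⟨ disjoint⇒∣p∣+∣q∣≤∣r∣ A∩N[S∩NA]∩S─NA≡∅ A∩N[S∩NA]⊆A∪S─NA (q⊆p∪q A S─NA) ⟩
      ∣ A ∪ S─NA ∣                ∎)
    where
    open ℕP.≤-Reasoning
    S∩NA : Subset n
    S∩NA = S ∩ N G A
    S─NA : Subset n
    S─NA = S ─ N G A
    indS─NA : IsIndependent G S─NA
    indS─NA = independent-⊆ indS (p─q⊆p S (N G A))
    hall : ∣ S∩NA ∣ ℕ.≤ ∣ A ∩ N G S∩NA ∣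
    hall = critical-independent-hall critIndA (p∩q⊆q S (N G A))
    A∩N[S∩NA]⊆A∪S─NA : A ∩ N G S∩NA ⊆ A ∪ S─NA
    A∩N[S∩NA]⊆A∪S─NA = ⊆-trans (p∩q⊆p A (N G S∩NA)) (p⊆p∪q S─NA)
    A∩N[S∩NA]∩S─NA≡∅ : ∀ {v} → v ∈ A ∩ N G S∩NA → v ∉ S─NA
    A∩N[S∩NA]∩S─NA≡∅ v∈A∩N[S∩NA] v∈S─NA = independent⇒∉N indS (p─q⊆p S (N G A) v∈S─NA)
      (N-mono (p∩q⊆p S (N G A)) (proj₂ (x∈p∩q⁻ A (N G S∩NA) v∈A∩N[S∩NA])))

  critical-independent⊆maximum-independent : ∀ {A} → IsCriticalIndependent G A →
    ∃ λ S → IsMaximumIndependent G S × A ⊆ S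
  critical-independent⊆maximum-independent critIndA =
    let M , indM , maxM = maximum-∣∣ independent? ∅-independent
        S , indS , A⊆S , ∣M∣≤∣S∣ = critical-independent-extends critIndA indM
    in S , (indS , λ I indI → ℕP.≤-trans (maxM I indI) ∣M∣≤∣S∣) , A⊆S

mainTheorem3 : ∀ {n : ℕ} (G : Graph n) (C : Subset n) →
    IsCore G C → IsCritical G C →
    ∀ A → IsMaximalCriticalIndependent G A → C ⊆ A
mainTheorem3 G C core critC A (critIndA , maximal) x∈C =
  let S , maxS , A⊆S = critical-independent⊆maximum-independent G critIndA
      C⊆S : C ⊆ S
      C⊆S {v} v∈C = proj₁ (core v) v∈C S maxS
      indA∪C : IsIndependent G (A ∪ C)
      indA∪C = independent-⊆ G (proj₁ maxS) (∪-least A⊆S C⊆S)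
  in maximal (A ∪ C) (∪-critical-independent G critIndA critC indA∪C) (p⊆p∪q C) (q⊆p∪q A C x∈C)
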